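{- $\vdash_\mathsf{F}$ is the smallest intro-elim logic; that is, $\vdash_\mathsf{F}$ is an intro-elim logic and $\vdash_\mathsf{F}\subseteq\vdash$ for every intro-elim logic $\vdash$.
   Context: Let $\mathsf{Prop}$ be a nonempty set of propositional variables and $\mathcal{L}$ the set of formulas given by $\varphi::= p\mid\neg\varphi\mid(\varphi\wedge\varphi)\mid(\varphi\vee\varphi)$ with $p\in\mathsf{Prop}$. An intro-elim logic is a binary relation $\vdash\,\subseteq\mathcal{L}\times\mathcal{L}$ such that for all $\varphi,\psi,\chi$: (1) $\varphi\vdash\varphi$; (2) $\varphi\wedge\psi\vdash\varphi$; (3) $\varphi\wedge\psi\vdash\psi$; (4) $\varphi\vdash\varphi\vee\psi$; (5) $\varphi\vdash\psi\vee\varphi$; (6) $\varphi\vdash\neg\neg\varphi$; (7) $\varphi\wedge\neg\varphi\vdash\psi$; (8) if $\varphi\vdash\psi$ and $\psi\vdash\chi$ then $\varphi\vdash\chi$; (9) if $\varphi\vdash\psi$ and $\varphi\vdash\chi$ then $\varphi\vdash\psi\wedge\chi$; (10) if $\varphi\vdash\chi$ and $\psi\vdash\chi$ then $\varphi\vee\psi\vdash\chi$; (11) if $\varphi\vdash\psi$ then $\neg\psi\vdash\neg\varphi$. The relation $\vdash_\mathsf{F}$ is defined by Fitch-style proofs. Proofs are finite sequences whose first entry is a formula and whose later entries are formulas or proofs. The set of proofs is the smallest set containing $\langle\varphi\rangle$ for every formula $\varphi$ and closed under the following, where $\langle\sigma_1,\dots,\sigma_n\rangle$ is a proof and $1\le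 i,j\le n$: (i) if $\tau$ is a proof, then $\langle\sigma_1,\dots,\sigma_n,\tau\rangle$ is a proof; ($\wedge$I) if $\sigma_i,\sigma_j$ are formulas, $\langle\sigma_1,\dots,\sigma_n,\sigma_i\wedge\sigma_j\rangle$ is a proof; ($\wedge$E) if $\sigma_i$ is $\varphi\wedge\psi$, then $\langle\sigma_1,\dots,\sigma_n,\varphi\rangle$ and $\langle\sigma_1,\dots,\sigma_n,\psi\rangle$ are proofs; ($\vee$I) if $\sigma_i$ is a formula, then for any formula $\varphi$, $\langle\sigma_1,\dots,\sigma_n,\sigma_i\vee\varphi\rangle$ and $\langle\sigma_1,\dots,\sigma_n,\varphi\vee\sigma_i\rangle$ are proofs; ($\vee$E) if $\sigma_i$ is $\varphi\vee\psi$, $\sigma_{n-1}$ is a sequence beginning with $\varphi$ and ending with $\chi$, and $\sigma_n$ is a sequence beginning with $\psi$ and ending with $\chi$, then $\langle\sigma_1,\dots,\sigma_n,\chi\rangle$ is a proof; ($\neg$I) if $\sigma_i$ is a formula $\psi$ and $\sigma_n$ is a sequence beginning with $\varphi$ and ending with $\neg\psi$, then $\langle\sigma_1,\dots,\sigma_n,\neg\varphi\rangle$ is a proof; ($\neg$E) if $\sigma_i$ is $\varphi$ and $\sigma_j$ is $\neg\varphi$, then for any formula $\psi$, $\langle\sigma_1,\dots,\sigma_n,\psi\rangle$ is a proof. Then $\varphi\vdash_\mathsf{F}\psi$ iff there is a proof whose first entry is $\varphi$ and whose last entry is $\psi$. -}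

module Defs where

open import Data.List using (List; []; _∷_; _∷ʳ_; _++_; [_]; head; last)
open import Data.List.Membership.Propositional using (_∈_)
open import Data.Maybe using (Maybe; just)
open import Data.Product using (Σ; _×_)
open import Relation.Binary.PropositionalEquality using (_≡_)

data Formula (A : Set) : Set where
  var  : A → Formula A
  ¬_   : Formula A → Formula A
  _∧_  : Formula A → Formula A → Formula A
  _∨_  : Formula A → Formula A → Formula A

infix  30 ¬_
infixr 20 _∧_
infixr 10 _∨_

module _ {A : Set} where

  record IsIntroElim (_⊢_ : Formula A → Formula A → Set) : Set where
    field
      refl⊢   : ∀ {φ} → φ ⊢ φ
      ∧E₁     : ∀ {φ ψ} → (φ ∧ ψ) ⊢ φ
      ∧E₂     : ∀ {φ ψ} → (φ ∧ ψ) ⊢ ψ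
      ∨I₁     : ∀ {φ ψ} → φ ⊢ (φ ∨ ψ)
      ∨I₂     : ∀ {φ ψ} → φ ⊢ (ψ ∨ φ)
      ¬¬I     : ∀ {φ} → φ ⊢ (¬ ¬ φ)
      explode : ∀ {φ ψ} → (φ ∧ ¬ φ) ⊢ ψ
      trans⊢  : ∀ {φ ψ χ} → φ ⊢ ψ → ψ ⊢ χ → φ ⊢ χ
      ∧I      : ∀ {φ ψ χ} → φ ⊢ ψ → φ ⊢ χ → φ ⊢ (ψ ∧ χ)
      ∨E      : ∀ {φ ψ χ} → φ ⊢ χ → ψ ⊢ χ → (φ ∨ ψ) ⊢ χ
      contra  : ∀ {φ ψ} → φ ⊢ ψ → (¬ ψ) ⊢ (¬ φ)

  data Entry : Set where
    form : Formula A → Entry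
    sub  : List Entry → Entry

  Begins : List Entry → Formula A → Set
  Begins σ φ = head σ ≡ just (form φ)

  Ends : List Entry → Formula A → Set
  Ends σ χ = last σ ≡ just (form χ)

  -- The set of Fitch proofs (smallest set closed under the rules).
  -- "σ_i is a formula φ" (for some 1 ≤ i ≤ n) is rendered as  form φ ∈ σ.
  data IsProof : List Entry → Set where
    start : ∀ φ → IsProof [ form φ ]
    subproof : ∀ {σ τ} → IsProof σ → IsProof τ → IsProof (σ ∷ʳ sub τ)
    ∧I : ∀ {σ φ ψ} → IsProof σ → form φ ∈ σ → form ψ ∈ σ →
         IsProof (σ ∷ʳ form (φ ∧ ψ))
    ∧E₁ : ∀ {σ φ ψ} → IsProof σ → form (φ ∧ ψ) ∈ σ → IsProof (σ ∷ʳ form φ)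
    ∧E₂ : ∀ {σ φ ψ} → IsProof σ → form (φ ∧ ψ) ∈ σ → IsProof (σ ∷ʳ form ψ)
    ∨I₁ : ∀ {σ φ} ψ → IsProof σ → form φ ∈ σ → IsProof (σ ∷ʳ form (φ ∨ ψ))
    ∨I₂ : ∀ {σ φ} ψ → IsProof σ → form φ ∈ σ → IsProof (σ ∷ʳ form (ψ ∨ φ))
    ∨E : ∀ {ρ τ₁ τ₂ φ ψ χ} → IsProof (ρ ++ sub τ₁ ∷ sub τ₂ ∷ []) →
         form (φ ∨ ψ) ∈ (ρ ++ sub τ₁ ∷ sub τ₂ ∷ []) →
         Begins τ₁ φ → Ends τ₁ χ → Begins τ₂ ψ → Ends τ₂ χ →
         IsProof ((ρ ++ sub τ₁ ∷ sub τ₂ ∷ []) ∷ʳ form χ)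
    ¬I : ∀ {ρ τ φ ψ} → IsProof (ρ ∷ʳ sub τ) → form ψ ∈ (ρ ∷ʳ sub τ) →
         Begins τ φ → Ends τ (¬ ψ) →
         IsProof ((ρ ∷ʳ sub τ) ∷ʳ form (¬ φ))
    ¬E : ∀ {σ φ} ψ → IsProof σ → form φ ∈ σ → form (¬ φ) ∈ σ →
         IsProof (σ ∷ʳ form ψ)

  _⊢F_ : Formula A → Formula A → Set
  φ ⊢F ψ = Σ (List Entry) λ σ → IsProof σ × Begins σ φ × Ends σ ψ

{-# OPTIONS --safe #-}
-- Minimality: every entry of a Fitch proof is a consequence of its first line in any
-- intro-elim logic, by induction over the proof, each Fitch rule being mirrored by the
-- corresponding closure condition (¬I via ψ ⊢ ¬¬ψ and contraposition). For the converse,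
-- the only rules that do not come from one-step proofs are transitivity and ∧I, and both
-- follow from a single device: a proof of ψ ⊢F χ can be cited inside any proof containing
-- ψ by the ∨-elimination of ψ ∨ ψ with that proof as both of its cases.
module Submission where

open import Data.List using (List; []; _∷_; _∷ʳ_; _++_; [_]; head; last)
open import Data.List.Properties using (++-assoc)
open import Data.List.Membership.Propositional using (_∈_)
open import Data.List.Membership.Propositional.Properties using (∈-++⁺ˡ; ∈-++⁺ʳ)
open import Data.List.Relation.Unary.All using (All; []; _∷_; lookup)
open import Data.List.Relation.Unary.All.Properties using (∷ʳ⁺)
open import Data.List.Relation.Unary.Any using (here; there)
open import Data.Maybe using (just)
open import Data.Product using (_×_; _,_)
open import Relation.Binary.PropositionalEquality using (_≡_; refl; trans; sym; subst)

open import Defs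

module _ {a} {X : Set a} where

  last-∷ʳ : (xs : List X) (x : X) → last (xs ∷ʳ x) ≡ just x
  last-∷ʳ []           x = refl
  last-∷ʳ (_ ∷ [])     x = refl
  last-∷ʳ (_ ∷ y ∷ xs) x = last-∷ʳ (y ∷ xs) x

  last-∈ : ∀ {xs : List X} {x} → last xs ≡ just x → x ∈ xs
  last-∈ {_ ∷ []}     refl = here refl
  last-∈ {_ ∷ _ ∷ _} eq   = there (last-∈ eq)

  head-∷ʳ-∷ʳ : (xs : List X) (x y : X) → head ((xs ∷ʳ x) ∷ʳ y) ≡ head (xs ∷ʳ x)
  head-∷ʳ-∷ʳ []      x y = refl
  head-∷ʳ-∷ʳ (_ ∷ _) x y = refl

module _ {A : Set} where

  head-∷ʳ : ∀ {σ} {y : Entry {A}} → IsProof σ → head (σ ∷ʳ y) ≡ head σ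
  head-∷ʳ (start _)                         = refl
  head-∷ʳ (subproof {σ} _ _)                = head-∷ʳ-∷ʳ σ _ _
  head-∷ʳ (∧I {σ} _ _ _)                    = head-∷ʳ-∷ʳ σ _ _
  head-∷ʳ (∧E₁ {σ} _ _)                     = head-∷ʳ-∷ʳ σ _ _
  head-∷ʳ (∧E₂ {σ} _ _)                     = head-∷ʳ-∷ʳ σ _ _
  head-∷ʳ (∨I₁ {σ} _ _ _)                   = head-∷ʳ-∷ʳ σ _ _
  head-∷ʳ (∨I₂ {σ} _ _ _)                   = head-∷ʳ-∷ʳ σ _ _
  head-∷ʳ (∨E {ρ} {τ₁} {τ₂} _ _ _ _ _ _)    = head-∷ʳ-∷ʳ (ρ ++ sub τ₁ ∷ sub τ₂ ∷ []) _ _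
  head-∷ʳ (¬I {ρ} {τ} _ _ _ _)              = head-∷ʳ-∷ʳ (ρ ∷ʳ sub τ) _ _
  head-∷ʳ (¬E {σ} _ _ _ _)                  = head-∷ʳ-∷ʳ σ _ _

  begins-∷ʳ⁻ : ∀ {σ y φ} → IsProof σ → Begins (σ ∷ʳ y) φ → Begins σ φ
  begins-∷ʳ⁻ p b = trans (sym (head-∷ʳ p)) b

  module _ {_⊢_ : Formula A → Formula A → Set} (isIntroElim : IsIntroElim _⊢_) where

    private module L = IsIntroElim isIntroElim

    Valid : Formula A → Entry → Set
    Valid φ (form χ) = φ ⊢ χ
    Valid φ (sub τ)  = ∀ {α χ} → Begins τ α → Ends τ χ → α ⊢ χ

    mutual
      valid-entries : ∀ {τ φ} → IsProof τ → Begins τ φ → All (Valid φ) τ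
      valid-entries (start _)               refl = L.refl⊢ ∷ []
      valid-entries (subproof p q)          b = extend p b λ _ → conclusion-valid q
      valid-entries (∧I p m₁ m₂)            b = extend p b λ V → L.∧I (lookup V m₁) (lookup V m₂)
      valid-entries (∧E₁ p m)               b = extend p b λ V → L.trans⊢ (lookup V m) L.∧E₁
      valid-entries (∧E₂ p m)               b = extend p b λ V → L.trans⊢ (lookup V m) L.∧E₂
      valid-entries (∨I₁ _ p m)             b = extend p b λ V → L.trans⊢ (lookup V m) L.∨I₁
      valid-entries (∨I₂ _ p m)             b = extend p b λ V → L.trans⊢ (lookup V m) L.∨I₂
      valid-entries (∨E {ρ} p m b₁ e₁ b₂ e₂) b = extend p b λ V →
        L.trans⊢ (lookup V m)
          (L.∨E (lookup V (∈-++⁺ʳ ρ (here refl)) b₁ e₁)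
                (lookup V (∈-++⁺ʳ ρ (there (here refl))) b₂ e₂))
      valid-entries (¬I {ρ} p m b₁ e₁)      b = extend p b λ V →
        L.trans⊢ (lookup V m) (L.trans⊢ L.¬¬I (L.contra (lookup V (∈-++⁺ʳ ρ (here refl)) b₁ e₁)))
      valid-entries (¬E _ p m₁ m₂)          b = extend p b λ V →
        L.trans⊢ (L.∧I (lookup V m₁) (lookup V m₂)) L.explode

      extend : ∀ {σ y φ} → IsProof σ → Begins (σ ∷ʳ y) φ →
               (All (Valid φ) σ → Valid φ y) → All (Valid φ) (σ ∷ʳ y)
      extend p b rule = let V = valid-entries p (begins-∷ʳ⁻ p b) in ∷ʳ⁺ V (rule V)

      conclusion-valid : ∀ {τ α χ} → IsProof τ → Begins τ α → Ends τ χ → α ⊢ χ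
      conclusion-valid p b e = lookup (valid-entries p b) (last-∈ e)

    ⊢F⇒⊢ : ∀ {φ ψ} → φ ⊢F ψ → φ ⊢ ψ
    ⊢F⇒⊢ (_ , p , b , e) = conclusion-valid p b e

  cite : ∀ {σ τ : List (Entry {A})} {ψ χ} →
         IsProof σ → form ψ ∈ σ → IsProof τ → Begins τ ψ → Ends τ χ →
         IsProof (((σ ∷ʳ form (ψ ∨ ψ)) ++ sub τ ∷ sub τ ∷ []) ∷ʳ form χ)
  cite {σ} {τ} {ψ} p m q b e = ∨E twice (∈-++⁺ˡ (∈-++⁺ʳ σ (here refl))) b e b e
    where
    twice : IsProof ((σ ∷ʳ form (ψ ∨ ψ)) ++ sub τ ∷ sub τ ∷ [])
    twice = subst IsProof (++-assoc (σ ∷ʳ _) _ _) (subproof (subproof (∨I₁ ψ p m) q) q)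

  ⊢F-trans : ∀ {φ ψ χ : Formula A} → φ ⊢F ψ → ψ ⊢F χ → φ ⊢F χ
  ⊢F-trans {ψ = ψ} (σ@(form _ ∷ _) , p , refl , e₁) (τ , q , b₂ , e₂) =
    _ , cite p (last-∈ {xs = σ} e₁) q b₂ e₂ , refl ,
    last-∷ʳ ((σ ∷ʳ form (ψ ∨ ψ)) ++ sub τ ∷ sub τ ∷ []) _

  ⊢F-∧I : ∀ {φ ψ χ : Formula A} → φ ⊢F ψ → φ ⊢F χ → φ ⊢F (ψ ∧ χ)
  ⊢F-∧I {φ} (_ , p , b₁ , e₁) (_ , q , b₂ , e₂) =
    -- the cited proof is  φ, φ ∨ φ, σ₁, σ₁, ψ, φ ∨ φ, σ₂, σ₂, χ
    _ , ∧I (cite (cite (start φ) (here refl) p b₁ e₁) (here refl) q b₂ e₂)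
           (there (there (there (there (here refl)))))
           (there (there (there (there (there (there (there (there (here refl)))))))))
      , refl , refl

  ⊢F-∨E : ∀ {φ ψ χ : Formula A} → φ ⊢F χ → ψ ⊢F χ → (φ ∨ ψ) ⊢F χ
  ⊢F-∨E {φ} {ψ} (_ , p , b₁ , e₁) (_ , q , b₂ , e₂) =
    _ , ∨E {ρ = [ form (φ ∨ ψ) ]} (subproof (subproof (start _) p) q) (here refl) b₁ e₁ b₂ e₂ ,
    refl , refl

  ⊢F-contra : ∀ {φ ψ : Formula A} → φ ⊢F ψ → (¬ ψ) ⊢F (¬ φ)
  ⊢F-contra {ψ = ψ} (σ@(form _ ∷ _) , p , refl , e) =
    _ , ¬I {ρ = [ form (¬ ψ) ]} (subproof (start (¬ ψ)) ¬¬ψ) (here refl) refl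
           (last-∷ʳ (σ ∷ʳ sub [ form (¬ ψ) ]) _)
      , refl , refl
    where
    ¬¬ψ : IsProof ((σ ∷ʳ sub [ form (¬ ψ) ]) ∷ʳ form (¬ ¬ ψ))
    ¬¬ψ = ¬I {ρ = σ} (subproof p (start (¬ ψ))) (∈-++⁺ˡ (last-∈ {xs = σ} e)) refl refl

  ⊢F-isIntroElim : IsIntroElim {A} _⊢F_
  ⊢F-isIntroElim = record
    { refl⊢   = _ , start _ , refl , refl
    ; ∧E₁     = _ , ∧E₁ (start _) (here refl) , refl , refl
    ; ∧E₂     = _ , ∧E₂ (start _) (here refl) , refl , refl
    ; ∨I₁     = _ , ∨I₁ _ (start _) (here refl) , refl , refl
    ; ∨I₂     = _ , ∨I₂ _ (start _) (here refl) , refl , refl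
    ; ¬¬I     = _ , ¬I {ρ = [ _ ]} (subproof (start _) (start _)) (here refl) refl refl , refl , refl
    ; explode = _ , ¬E _ (∧E₂ (∧E₁ (start _) (here refl)) (here refl))
                         (there (here refl)) (there (there (here refl))) , refl , refl
    ; trans⊢  = ⊢F-trans
    ; ∧I      = ⊢F-∧I
    ; ∨E      = ⊢F-∨E
    ; contra  = ⊢F-contra
    }

proposition3p8 : (A : Set) → A →
    IsIntroElim {A} _⊢F_ ×
    ((_⊢_ : Formula A → Formula A → Set) → IsIntroElim _⊢_ →
      ∀ φ ψ → φ ⊢F ψ → φ ⊢ ψ)
proposition3p8 A _ = ⊢F-isIntroElim , λ _ isIntroElim _ _ → ⊢F⇒⊢ isIntroElim
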